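{- Let $S$ be a set and consider the magma $(\mathcal{P}(S),\cup)$ of all subsets of $S$ with the union operation. For every odd integer $n\geq 5$, the cycle graph $C_n$ is not a sum graph over $(\mathcal{P}(S),\cup)$ (for any set $S$). For every integer $k\geq 2$, if $S$ is a set with $2k$ elements, then the cycle graph $C_{2k}$ is a sum graph over $(\mathcal{P}(S),\cup)$.
   Context: Given a magma $(M,\oplus)$ and a finite subset $V\subseteq M$, $\mathcal{G}_M(V)$ denotes the simple graph with vertex set $V$ in which two distinct vertices $v,w$ are adjacent if and only if $v\oplus w\in V$ or $w\oplus v\in V$. A graph $G$ is a sum graph over $M$ if $G$ is isomorphic to $\mathcal{G}_M(V)$ for some $V\subseteq M$. $C_n$ denotes the cycle graph on $n$ vertices. -}

module Defs where

open import Level using (Level; _⊔_; 0ℓ) renaming (suc to lsuc)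
open import Data.Nat using (ℕ; zero; suc)
open import Data.Fin using (Fin; toℕ)
open import Data.Product using (Σ; ∃; _×_; _,_)
open import Data.Sum using (_⊎_; inj₁; inj₂)
open import Relation.Nullary using (¬_)
open import Relation.Binary.PropositionalEquality using (_≡_)
open import Relation.Unary using (Pred; _∪_; _≐_)
open import Algebra.Bundles using (Magma)
open import Algebra.Structures using (IsMagma)
open import Function.Bundles using (_↔_; Inverse)

-- The magma (P(S), ∪): subsets of S are predicates on S, equality of
-- subsets is extensional equality (mutual inclusion), operation is union.
powerSetUnion : (S : Set) → Magma (lsuc 0ℓ) 0ℓ
powerSetUnion S = record
  { Carrier = Pred S 0ℓ
  ; _≈_ = _≐_
  ; _∙_ = _∪_
  ; isMagma = record
    { isEquivalence = record
      { refl = (λ x → x) , (λ x → x)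
      ; sym = λ { (p , q) → q , p }
      ; trans = λ { (p , q) (r , s) → (λ x → r (p x)) , (λ x → q (s x)) }
      }
    ; ∙-cong = λ { (p , q) (r , s) →
        (λ { (inj₁ x) → inj₁ (p x) ; (inj₂ x) → inj₂ (r x) }) ,
        (λ { (inj₁ x) → inj₁ (q x) ; (inj₂ x) → inj₂ (s x) }) }
    }
  }

-- A simple graph on vertex set Fin n, given by its adjacency relation.
-- The cycle graph C_n on vertices 0,…,n-1 (i ~ i+1 mod n); meant for n ≥ 3.
CycleAdj : (n : ℕ) → Fin n → Fin n → Set
CycleAdj n i j =
  (toℕ j ≡ suc (toℕ i)) ⊎ (toℕ i ≡ suc (toℕ j)) ⊎
  ((toℕ i ≡ 0) × (suc (toℕ j) ≡ n)) ⊎ ((toℕ j ≡ 0) × (suc (toℕ i) ≡ n))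

module _ {c ℓ : Level} (M : Magma c ℓ) where
  open Magma M

  -- A finite subset V ⊆ M with m elements, listed without repetition
  -- as an injective family f : Fin m → M.
  InjectiveFamily : {m : ℕ} → (Fin m → Carrier) → Set ℓ
  InjectiveFamily f = ∀ i j → f i ≈ f j → i ≡ j

  _∈V_ : Carrier → {m : ℕ} → (Fin m → Carrier) → Set ℓ
  x ∈V f = ∃ λ k → f k ≈ x

  SumAdj : {m : ℕ} → (Fin m → Carrier) → Fin m → Fin m → Set ℓ
  SumAdj f i j = ¬ (i ≡ j) × (((f i ∙ f j) ∈V f) ⊎ ((f j ∙ f i) ∈V f))

  IsSumGraph : (n : ℕ) → (Fin n → Fin n → Set) → Set (c ⊔ ℓ)
  IsSumGraph n Adj =
    Σ ℕ λ m → Σ (Fin m → Carrier) λ f → InjectiveFamily f ×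
      Σ (Fin n ↔ Fin m) λ σ →
        ∀ i j → (Adj i j → SumAdj f (Inverse.to σ i) (Inverse.to σ j))
              × (SumAdj f (Inverse.to σ i) (Inverse.to σ j) → Adj i j)

{-# OPTIONS --safe #-}

-- In (P(S), ∪) two distinct vertices whose sets are comparable are adjacent, their
-- union being the larger one.  In a triangle-free sum graph the converse holds: the
-- union of an edge is a vertex containing both ends, hence adjacent to both, so it is
-- one of the ends.  Along a cycle C_n with n ≥ 4, two consecutive edges cannot both
-- go up (or both down) for ⊆, since the vertices at distance two would become
-- adjacent; the directions therefore alternate, which is impossible around an odd
-- cycle.  Conversely, a bipartite graph is realised by giving each vertex of one side
-- the singleton {v} and each vertex of the other side its closed neighbourhood; even
-- cycles are bipartite by the parity of the index.
module Submission where

open import Defs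
open import Level using (0ℓ)
open import Data.Empty using (⊥; ⊥-elim)
open import Data.Fin using (Fin; zero; toℕ; _≟_)
open import Data.Fin.Properties using (toℕ-injective; toℕ-fromℕ<; toℕ<n)
open import Data.Nat
  using (ℕ; zero; suc; parity; _+_; _*_; _≤_; _<_; NonZero; >-nonZero; z≤n; z<s; s≤s; _%_; _/_)
open import Data.Nat.Properties
  using (+-comm; +-cancelˡ-≡; <⇒≱; ≤-trans; n≤1+n; m≤n⇒m<n∨m≡n; 1+n≢0; suc-injective)
open import Data.Nat.DivMod
  using (_mod_; %-congˡ; %-distribˡ-+; m%n%n≡m%n; m≡m%n+[m/n]*n; m<n⇒m%n≡m; n%n≡0; [m+n]%n≡m%n)
open import Data.Nat.Divisibility using (_∣_; divides; ∣⇒≤)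
open import Data.Nat.GeneralisedArithmetic using (fold)
open import Data.Parity.Base using (Parity; 0ℙ; 1ℙ)
open import Data.Parity.Properties using (p≢p⁻¹; suc-homo-⁻¹; *-homo-*)
open import Data.Product using (_×_; ∃-syntax; _,_; proj₁; proj₂)
open import Data.Sum using (_⊎_; inj₁; inj₂; [_,_])
import Data.Sum as Sum
open import Function.Base using (_∘_; id)
open import Function.Bundles using (_↔_; Inverse; Injection)
open import Function.Properties.Inverse using (↔-refl; ↔⇒↣)
open import Relation.Binary.PropositionalEquality
  using (_≡_; _≢_; refl; sym; trans; cong; subst; module ≡-Reasoning)
open import Relation.Nullary using (¬_; yes; no)
open import Relation.Unary using (Pred; _⊆_; _∪_)

[m+n%d]%d≡[m+n]%d : ∀ m n d .{{_ : NonZero d}} → (m + n % d) % d ≡ (m + n) % d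
[m+n%d]%d≡[m+n]%d m n d = begin
  (m + n % d) % d          ≡⟨ %-distribˡ-+ m (n % d) d ⟩
  (m % d + n % d % d) % d  ≡⟨ cong (λ x → (m % d + x) % d) (m%n%n≡m%n n d) ⟩
  (m % d + n % d) % d      ≡⟨ %-distribˡ-+ m n d ⟨
  (m + n) % d              ∎
  where open ≡-Reasoning

-- If (k + a) mod n = a, then k + a = a + q n, so n ∣ k.
[k+a]%n≢a : ∀ {k n} a .{{_ : NonZero n}} → 0 < k → k < n → (k + a) % n ≢ a
[k+a]%n≢a {k} {n} a 0<k k<n eq = <⇒≱ k<n (∣⇒≤ {{>-nonZero 0<k}} (divides q k≡q*n))
  where
  q : ℕ
  q = (k + a) / n

  k≡q*n : k ≡ q * n
  k≡q*n = +-cancelˡ-≡ a k (q * n) (begin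
    a + k                    ≡⟨ +-comm a k ⟩
    k + a                    ≡⟨ m≡m%n+[m/n]*n (k + a) n ⟩
    (k + a) % n + q * n      ≡⟨ cong (_+ q * n) eq ⟩
    a + q * n                ∎)
    where open ≡-Reasoning

¬2∣⇒≡1+q*2 : ∀ {n} → ¬ 2 ∣ n → ∃[ q ] n ≡ 1 + q * 2
¬2∣⇒≡1+q*2 {zero}  ¬2∣0 = ⊥-elim (¬2∣0 (divides 0 refl))
¬2∣⇒≡1+q*2 {suc zero} _ = 0 , refl
¬2∣⇒≡1+q*2 {suc (suc n)} ¬2∣2+n
  with ¬2∣⇒≡1+q*2 {n} (λ { (divides q n≡q*2) → ¬2∣2+n (divides (suc q) (cong (2 +_) n≡q*2)) })
... | q , n≡1+q*2 = suc q , cong (2 +_) n≡1+q*2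

Successor : (n : ℕ) → Fin n → Fin n → Set
Successor n i j = toℕ j ≡ suc (toℕ i) ⊎ (toℕ j ≡ 0 × suc (toℕ i) ≡ n)

module _ {n : ℕ} {i j : Fin n} where

  cycleAdj⇒successor : CycleAdj n i j → Successor n i j ⊎ Successor n j i
  cycleAdj⇒successor (inj₁ e)               = inj₁ (inj₁ e)
  cycleAdj⇒successor (inj₂ (inj₁ e))        = inj₂ (inj₁ e)
  cycleAdj⇒successor (inj₂ (inj₂ (inj₁ e))) = inj₂ (inj₂ e)
  cycleAdj⇒successor (inj₂ (inj₂ (inj₂ e))) = inj₁ (inj₂ e)

  successor⇒cycleAdj : Successor n i j → CycleAdj n i j
  successor⇒cycleAdj (inj₁ e) = inj₁ e
  successor⇒cycleAdj (inj₂ e) = inj₂ (inj₂ (inj₂ e))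

  cycleAdj-sym : CycleAdj n i j → CycleAdj n j i
  cycleAdj-sym (inj₁ e)               = inj₂ (inj₁ e)
  cycleAdj-sym (inj₂ (inj₁ e))        = inj₁ e
  cycleAdj-sym (inj₂ (inj₂ (inj₁ e))) = inj₂ (inj₂ (inj₂ e))
  cycleAdj-sym (inj₂ (inj₂ (inj₂ e))) = inj₂ (inj₂ (inj₁ e))

successor-injective : ∀ {n} {i i′ j : Fin n} → Successor n i j → Successor n i′ j → i ≡ i′
successor-injective (inj₁ j≡1+i) (inj₁ j≡1+i′) =
  toℕ-injective (suc-injective (trans (sym j≡1+i) j≡1+i′))
successor-injective (inj₂ (_ , 1+i≡n)) (inj₂ (_ , 1+i′≡n)) =
  toℕ-injective (suc-injective (trans 1+i≡n (sym 1+i′≡n)))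
successor-injective (inj₁ j≡1+i) (inj₂ (j≡0 , _)) = ⊥-elim (1+n≢0 (trans (sym j≡1+i) j≡0))
successor-injective (inj₂ (j≡0 , _)) (inj₁ j≡1+i′) = ⊥-elim (1+n≢0 (trans (sym j≡1+i′) j≡0))

module _ {n : ℕ} .{{_ : NonZero n}} where

  next : Fin n → Fin n
  next i = suc (toℕ i) mod n

  toℕ-next : (i : Fin n) → toℕ (next i) ≡ suc (toℕ i) % n
  toℕ-next i = toℕ-fromℕ< _

  successor-next : (i : Fin n) → Successor n i (next i)
  successor-next i with m≤n⇒m<n∨m≡n (toℕ<n i)
  ... | inj₁ 1+i<n = inj₁ (trans (toℕ-next i) (m<n⇒m%n≡m 1+i<n))
  ... | inj₂ 1+i≡n = inj₂ (trans (toℕ-next i) (trans (%-congˡ 1+i≡n) (n%n≡0 n)) , 1+i≡n)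

  successor⇒≡next : ∀ {i j : Fin n} → Successor n i j → j ≡ next i
  successor⇒≡next {i} {j} (inj₁ j≡1+i) = toℕ-injective (begin
    toℕ j              ≡⟨ j≡1+i ⟩
    suc (toℕ i)        ≡⟨ m<n⇒m%n≡m (subst (_< n) j≡1+i (toℕ<n j)) ⟨
    suc (toℕ i) % n    ≡⟨ toℕ-next i ⟨
    toℕ (next i)       ∎)
    where open ≡-Reasoning
  successor⇒≡next {i} {j} (inj₂ (j≡0 , 1+i≡n)) = toℕ-injective (begin
    toℕ j              ≡⟨ j≡0 ⟩
    0                  ≡⟨ n%n≡0 n ⟨
    n % n              ≡⟨ %-congˡ 1+i≡n ⟨
    suc (toℕ i) % n    ≡⟨ toℕ-next i ⟨
    toℕ (next i)       ∎)
    where open ≡-Reasoning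

  cycleAdj⇒next : ∀ {i j : Fin n} → CycleAdj n i j → j ≡ next i ⊎ i ≡ next j
  cycleAdj⇒next = Sum.map successor⇒≡next successor⇒≡next ∘ cycleAdj⇒successor

  cycleAdj-next : (i : Fin n) → CycleAdj n i (next i)
  cycleAdj-next = successor⇒cycleAdj ∘ successor-next

  next-injective : ∀ {i i′ : Fin n} → next i ≡ next i′ → i ≡ i′
  next-injective {i} {i′} e =
    successor-injective (successor-next i) (subst (Successor n i′) (sym e) (successor-next i′))

  toℕ-fold-next : ∀ k (i : Fin n) → toℕ (fold i next k) ≡ (k + toℕ i) % n
  toℕ-fold-next zero    i = sym (m<n⇒m%n≡m (toℕ<n i))
  toℕ-fold-next (suc k) i = begin
    toℕ (next (fold i next k))      ≡⟨ toℕ-next (fold i next k) ⟩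
    suc (toℕ (fold i next k)) % n   ≡⟨ %-congˡ (cong suc (toℕ-fold-next k i)) ⟩
    (1 + (k + toℕ i) % n) % n       ≡⟨ [m+n%d]%d≡[m+n]%d 1 (k + toℕ i) n ⟩
    (suc k + toℕ i) % n             ∎
    where open ≡-Reasoning

  fold-next≢ : ∀ {k} → 0 < k → k < n → (i : Fin n) → fold i next k ≢ i
  fold-next≢ {k} 0<k k<n i e =
    [k+a]%n≢a (toℕ i) 0<k k<n (trans (sym (toℕ-fold-next k i)) (cong toℕ e))

  fold-next-period : (i : Fin n) → fold i next n ≡ i
  fold-next-period i = toℕ-injective (begin
    toℕ (fold i next n)   ≡⟨ toℕ-fold-next n i ⟩
    (n + toℕ i) % n       ≡⟨ %-congˡ (+-comm n (toℕ i)) ⟩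
    (toℕ i + n) % n       ≡⟨ [m+n]%n≡m%n (toℕ i) n ⟩
    toℕ i % n             ≡⟨ m<n⇒m%n≡m (toℕ<n i) ⟩
    toℕ i                 ∎)
    where open ≡-Reasoning

TriangleFree : {n : ℕ} → (Fin n → Fin n → Set) → Set
TriangleFree Adj = ∀ {i j l} → i ≢ l → j ≢ l → Adj i j → Adj j l → Adj i l → ⊥

module _ {n : ℕ} .{{_ : NonZero n}} (4≤n : 4 ≤ n) where

  private
    1<n : 1 < n
    1<n = ≤-trans (s≤s (s≤s z≤n)) 4≤n

    2<n : 2 < n
    2<n = ≤-trans (s≤s (s≤s (s≤s z≤n))) 4≤n

  next²≢ : (i : Fin n) → i ≢ next (next i)
  next²≢ i = fold-next≢ z<s 2<n i ∘ sym

  ¬cycleAdj-next² : (i : Fin n) → ¬ CycleAdj n i (next (next i))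
  ¬cycleAdj-next² i a with cycleAdj⇒next a
  ... | inj₁ next²i≡next-i = fold-next≢ z<s 1<n i (next-injective next²i≡next-i)
  ... | inj₂ i≡next³i      = fold-next≢ z<s 4≤n i (sym i≡next³i)

  next-¬commonNeighbour : ∀ {i l} → i ≢ l → next i ≢ l →
                          CycleAdj n (next i) l → CycleAdj n i l → ⊥
  next-¬commonNeighbour {i} i≢l next-i≢l jl il with cycleAdj⇒next jl
  ... | inj₂ next-i≡next-l = i≢l (next-injective next-i≡next-l)
  ... | inj₁ refl with cycleAdj⇒next il
  ...   | inj₁ next²i≡next-i = next-i≢l (sym next²i≡next-i)
  ...   | inj₂ i≡next³i      = fold-next≢ z<s 4≤n i (sym i≡next³i)

  cycle-triangleFree : TriangleFree (CycleAdj n)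
  cycle-triangleFree i≢l j≢l ij jl il with cycleAdj⇒next ij
  ... | inj₁ refl = next-¬commonNeighbour i≢l j≢l jl il
  ... | inj₂ refl = next-¬commonNeighbour j≢l i≢l il jl

module _ {A : Set} (s : A → A) (P : A → Set)
         (P⇒¬Ps : ∀ {x} → P x → ¬ P (s x)) (¬P⇒Ps : ∀ {x} → ¬ P x → P (s x)) where

  alternating⇒no-odd-orbit : ∀ q x → fold x s (1 + q * 2) ≢ x
  alternating⇒no-odd-orbit q x orbit = ¬Px (subst P orbit (¬P⇒Ps (¬P-even q ¬Px)))
    where
    P-even : ∀ q {y} → P y → P (fold y s (q * 2))
    P-even zero    = id
    P-even (suc q) = ¬P⇒Ps ∘ P⇒¬Ps ∘ P-even q

    ¬P-even : ∀ q {y} → ¬ P y → ¬ P (fold y s (q * 2))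
    ¬P-even zero    = id
    ¬P-even (suc q) = P⇒¬Ps ∘ ¬P⇒Ps ∘ ¬P-even q

    ¬Px : ¬ P x
    ¬Px Px = P⇒¬Ps (P-even q Px) (subst P (sym orbit) Px)

module UnionSumGraph {S : Set} {n : ℕ} {Adj : Fin n → Fin n → Set}
                     (G : IsSumGraph (powerSetUnion S) n Adj) where

  private
    m : ℕ
    m = proj₁ G

    f : Fin m → Pred S 0ℓ
    f = proj₁ (proj₂ G)

    σ : Fin n ↔ Fin m
    σ = proj₁ (proj₂ (proj₂ (proj₂ G)))

    open Inverse σ using (to; from; strictlyInverseˡ)

    sumAdj⇒adj : ∀ i j → SumAdj (powerSetUnion S) f (to i) (to j) → Adj i j
    sumAdj⇒adj i j = proj₂ (proj₂ (proj₂ (proj₂ (proj₂ G))) i j)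

    adj⇒sumAdj : ∀ i j → Adj i j → SumAdj (powerSetUnion S) f (to i) (to j)
    adj⇒sumAdj i j = proj₁ (proj₂ (proj₂ (proj₂ (proj₂ G))) i j)

  F : Fin n → Pred S 0ℓ
  F i = f (to i)

  private
    f⊆F[from] : ∀ k → f k ⊆ F (from k)
    f⊆F[from] k {x} = subst (λ k′ → f k′ x) (sym (strictlyInverseˡ k))

  ⊆⇒adj : ∀ {i j} → i ≢ j → F i ⊆ F j → Adj i j
  ⊆⇒adj {i} {j} i≢j Fi⊆Fj =
    sumAdj⇒adj i j (i≢j ∘ Injection.injective (↔⇒↣ σ) , inj₁ (to j , inj₂ , [ Fi⊆Fj , id ]))

  adj⇒join : ∀ {i j} → Adj i j → ∃[ l ] (F i ∪ F j) ⊆ F l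
  adj⇒join {i} {j} a with proj₂ (adj⇒sumAdj i j a)
  ... | inj₁ (k , _ , ij⊆k) = from k , f⊆F[from] k ∘ ij⊆k
  ... | inj₂ (k , _ , ji⊆k) = from k , f⊆F[from] k ∘ ji⊆k ∘ Sum.swap

  adj⇒⊆⊎⊇ : TriangleFree Adj → ∀ {i j} → Adj i j → F i ⊆ F j ⊎ F j ⊆ F i
  adj⇒⊆⊎⊇ triangleFree {i} {j} a with adj⇒join a
  ... | l , ij⊆l with l ≟ i | l ≟ j
  ...   | yes refl | _        = inj₂ (ij⊆l ∘ inj₂)
  ...   | no _     | yes refl = inj₁ (ij⊆l ∘ inj₁)
  ...   | no l≢i   | no l≢j   =
    ⊥-elim (triangleFree (l≢i ∘ sym) (l≢j ∘ sym) a (⊆⇒adj (l≢j ∘ sym) (ij⊆l ∘ inj₂))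
                                                    (⊆⇒adj (l≢i ∘ sym) (ij⊆l ∘ inj₁)))

module OddCycle {S : Set} {n : ℕ} .{{_ : NonZero n}} (4≤n : 4 ≤ n)
                (G : IsSumGraph (powerSetUnion S) n (CycleAdj n)) where

  open UnionSumGraph G

  edge-comparable : ∀ {i j} → CycleAdj n i j → F i ⊆ F j ⊎ F j ⊆ F i
  edge-comparable = adj⇒⊆⊎⊇ (cycle-triangleFree 4≤n)

  Ascends : Fin n → Set
  Ascends i = F i ⊆ F (next i)

  ascends⇒¬ascends-next : ∀ {i} → Ascends i → ¬ Ascends (next i)
  ascends⇒¬ascends-next {i} up up′ =
    ¬cycleAdj-next² 4≤n i (⊆⇒adj (next²≢ 4≤n i) (up′ ∘ up))

  ¬ascends⇒ascends-next : ∀ {i} → ¬ Ascends i → Ascends (next i)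
  ¬ascends⇒ascends-next {i} ¬up with edge-comparable (cycleAdj-next i)
  ... | inj₁ up   = ⊥-elim (¬up up)
  ... | inj₂ down with edge-comparable (cycleAdj-next (next i))
  ...   | inj₁ up′  = up′
  ...   | inj₂ down′ = ⊥-elim
    (¬cycleAdj-next² 4≤n i (cycleAdj-sym (⊆⇒adj (next²≢ 4≤n i ∘ sym) (down ∘ down′))))

oddCycle-¬sumGraph : ∀ {S n} → 4 ≤ n → ¬ 2 ∣ n → ¬ IsSumGraph (powerSetUnion S) n (CycleAdj n)
oddCycle-¬sumGraph {n = suc _} 4≤n n-odd G with ¬2∣⇒≡1+q*2 n-odd
... | q , refl = let open OddCycle 4≤n G in
  alternating⇒no-odd-orbit next Ascends ascends⇒¬ascends-next ¬ascends⇒ascends-next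
                           q zero (fold-next-period zero)

module Bipartite {n : ℕ} {Adj : Fin n → Fin n → Set}
                 (adj-sym : ∀ {i j} → Adj i j → Adj j i)
                 (colour : Fin n → Parity) (proper : ∀ {i j} → Adj i j → colour i ≢ colour j)
                 {S : Set} (S↔V : S ↔ Fin n) where

  open Inverse S↔V using (to; from; strictlyInverseˡ)

  _∈N[_] : Fin n → Fin n → Set
  x ∈N[ t ] = x ≡ t ⊎ (colour t ≡ 1ℙ × Adj x t)

  V : Fin n → Pred S 0ℓ
  V t s = to s ∈N[ t ]

  from∈V⇒∈N : ∀ {x t} → V t (from x) → x ∈N[ t ]
  from∈V⇒∈N {x} {t} = subst (_∈N[ t ]) (strictlyInverseˡ x)

  from∈V : ∀ t → V t (from t)
  from∈V t = inj₁ (strictlyInverseˡ t)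

  other-colour : ∀ {i j} → Adj i j → colour i ≡ 0ℙ → colour j ≡ 1ℙ
  other-colour {j = j} a ci≡0 with colour j | proper a
  ... | 1ℙ | _    = refl
  ... | 0ℙ | ci≢0 = ⊥-elim (ci≢0 ci≡0)

  0ℙ-endpoint : ∀ {i j} → Adj i j → colour i ≡ 0ℙ ⊎ colour j ≡ 0ℙ
  0ℙ-endpoint {i} {j} a with colour i | colour j | proper a
  ... | 0ℙ | _  | _     = inj₁ refl
  ... | 1ℙ | 0ℙ | _     = inj₂ refl
  ... | 1ℙ | 1ℙ | ci≢cj = ⊥-elim (ci≢cj refl)

  0ℙ⊆neighbour : ∀ {i j} → Adj i j → colour i ≡ 0ℙ → V i ⊆ V j
  0ℙ⊆neighbour a ci≡0 (inj₁ refl)        = inj₂ (other-colour a ci≡0 , a)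
  0ℙ⊆neighbour a ci≡0 (inj₂ (ci≡1 , _)) with trans (sym ci≡0) ci≡1
  ... | ()

  ¬∈N[neighbour] : ∀ {i l} → Adj i l → colour l ≡ 1ℙ → ¬ l ∈N[ i ]
  ¬∈N[neighbour] a cl≡1 (inj₁ refl)        = proper a refl
  ¬∈N[neighbour] a cl≡1 (inj₂ (ci≡1 , _)) = proper a (trans ci≡1 (sym cl≡1))

  V-injective : InjectiveFamily (powerSetUnion S) V
  V-injective i j (Vi⊆Vj , Vj⊆Vi) with from∈V⇒∈N (Vi⊆Vj (from∈V i)) | from∈V⇒∈N (Vj⊆Vi (from∈V j))
  ... | inj₁ i≡j         | _                 = i≡j
  ... | _                | inj₁ j≡i          = sym j≡i
  ... | inj₂ (cj≡1 , a)  | inj₂ (ci≡1 , _)   = ⊥-elim (proper a (trans ci≡1 (sym cj≡1)))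

  adj⇒sumAdj : ∀ {i j} → Adj i j → SumAdj (powerSetUnion S) V i j
  adj⇒sumAdj {i} {j} a with 0ℙ-endpoint a
  ... | inj₁ ci≡0 = proper a ∘ cong colour , inj₁ (j , inj₂ , [ 0ℙ⊆neighbour a ci≡0 , id ])
  ... | inj₂ cj≡0 = proper a ∘ cong colour , inj₁ (i , inj₁ , [ id , 0ℙ⊆neighbour (adj-sym a) cj≡0 ])

  join⇒adj : ∀ {i j l} → i ≢ j → (V i ∪ V j) ⊆ V l → V l ⊆ (V i ∪ V j) → Adj i j
  join⇒adj {i} {j} {l} i≢j ij⊆l l⊆ij
    with from∈V⇒∈N (ij⊆l (inj₁ (from∈V i))) | from∈V⇒∈N (ij⊆l (inj₂ (from∈V j)))
  ... | inj₁ refl        | inj₁ refl         = ⊥-elim (i≢j refl)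
  ... | inj₁ refl        | inj₂ (_ , jl)     = adj-sym jl
  ... | inj₂ (_ , il)    | inj₁ refl         = il
  ... | inj₂ (cl≡1 , il) | inj₂ (_ , jl)     =
    ⊥-elim ([ ¬∈N[neighbour] il cl≡1 ∘ from∈V⇒∈N , ¬∈N[neighbour] jl cl≡1 ∘ from∈V⇒∈N ]
              (l⊆ij (from∈V l)))

  sumAdj⇒adj : ∀ {i j} → SumAdj (powerSetUnion S) V i j → Adj i j
  sumAdj⇒adj (i≢j , inj₁ (_ , l⊆ij , ij⊆l)) = join⇒adj i≢j ij⊆l l⊆ij
  sumAdj⇒adj (i≢j , inj₂ (_ , l⊆ji , ji⊆l)) =
    adj-sym (join⇒adj (i≢j ∘ sym) ji⊆l l⊆ji)

  bipartite-sumGraph : IsSumGraph (powerSetUnion S) n Adj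
  bipartite-sumGraph = n , V , V-injective , ↔-refl , λ i j → adj⇒sumAdj , sumAdj⇒adj

parity≢parity-suc : ∀ m → parity m ≢ parity (suc m)
parity≢parity-suc m e = p≢p⁻¹ (parity (suc m)) (sym (trans (suc-homo-⁻¹ m) e))

successor-parity : ∀ k {i j : Fin (2 * k)} → Successor (2 * k) i j →
                   parity (toℕ j) ≡ parity (suc (toℕ i))
successor-parity k (inj₁ j≡1+i)         = cong parity j≡1+i
successor-parity k (inj₂ (j≡0 , 1+i≡n)) =
  trans (cong parity j≡0) (sym (trans (cong parity 1+i≡n) (*-homo-* 2 k)))

evenCycle-properColouring : ∀ k {i j : Fin (2 * k)} → CycleAdj (2 * k) i j →
                            parity (toℕ i) ≢ parity (toℕ j)
evenCycle-properColouring k {i} {j} a pi≡pj with cycleAdj⇒successor a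
... | inj₁ s = parity≢parity-suc (toℕ i) (trans pi≡pj (successor-parity k s))
... | inj₂ s = parity≢parity-suc (toℕ j) (trans (sym pi≡pj) (successor-parity k s))

mainTheorem1 : ((S : Set) (n : ℕ) → 5 ≤ n → ¬ (2 ∣ n) →
    ¬ IsSumGraph (powerSetUnion S) n (CycleAdj n))
    ×
    ((k : ℕ) → 2 ≤ k → (S : Set) → S ↔ Fin (2 * k) →
    IsSumGraph (powerSetUnion S) (2 * k) (CycleAdj (2 * k)))
mainTheorem1 =
  (λ S n 5≤n n-odd → oddCycle-¬sumGraph (≤-trans (n≤1+n 4) 5≤n) n-odd) ,
  -- The construction also works for k < 2.
  λ k _ S S↔V → Bipartite.bipartite-sumGraph cycleAdj-sym (parity ∘ toℕ)
                                            (evenCycle-properColouring k) S↔V
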